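{- Let $n_1,\dots,n_r$ be positive integers and $P=Q_{n_1}\times\cdots\times Q_{n_r}$. For each $i$ let $\mathcal{F}^1_i,\mathcal{F}^2_i$ be a pair of almost orthogonal symmetric chain decompositions of $Q_{n_i}$. Let $A_i\in\mathcal{F}^1_i$ and $B_i\in\mathcal{F}^2_i$ for $1\le i\le r$, and suppose the cuboid $A_1\times\cdots\times A_r$ has a proper decomposition $\mathcal{X}$. Let $\mathcal{Y}$ be any decomposition of the cuboid $B_1\times\cdots\times B_r$ into chains that are symmetric with respect to that cuboid. Then for all $X\in\mathcal{X}$ and $Y\in\mathcal{Y}$ we have $|X\cap Y|\le1$, unless all $A_i$ and $B_i$ are maximal chains (contain $\varnothing$ and $[n_i]$); in that exceptional case the same holds except that the chain of $\mathcal{X}$ and the chain of $\mathcal{Y}$ containing the minimum and maximum of $P$ intersect in precisely these two elements.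
   Context: $Q_n$ is the Boolean lattice of subsets of $[n]$ under inclusion; $P$ has the product order, and the rank of $a=(a_1,\dots,a_r)\in P$ is $\sum|a_i|$. A symmetric chain in $Q_n$ consists of exactly one subset of each size $j,\dots,n-j$ for some $j$; a symmetric chain decomposition (SCD) is a partition into symmetric chains. Two SCDs $\mathcal{F},\mathcal{G}$ of $Q_n$ are almost orthogonal if for all $A\in\mathcal{F}$, $B\in\mathcal{G}$, $|A\cap B|\le1$, except when $A,B$ both contain $\varnothing$ and $[n]$, in which case $|A\cap B|=2$. For chains $C_1,\dots,C_r$ with $C_i$ a chain in $Q_{n_i}$ skipping no ranks, the cuboid $C_1\times\cdots\times C_r\subseteq P$ is graded with rank of $(c_1,\dots,c_r)$ equal to $\sum_i(\text{position of }c_i\text{ in }C_i,\text{ counted from }0)$ and top rank $N=\sum_i(|C_i|-1)$; a chain in the cuboid is symmetric with respect to it if it has exactly one element of each rank $j,j+1,\dots,N-j$ for some $j$. A chain in $P$ skips no ranks if its set of ranks is an integer interval. A chain in $P$ skipping no ranks is proper if for every pair of distinct elements $a,a'$ of it, other than the pair consisting of the minimum $(\varnothing,\dots,\varnothing)$ and maximum $([n_1],\dots,[n_r])$ of $P$, there is an index $i$ with $a_i\neq a'_i$ and $\{a_i,a'_i\}\neq\{\varnothing,[n_i]\}$. A proper decomposition of a cuboid is a partition of it into chains that are symmetric with respect to the cuboid and proper in $P$. -}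

module Defs where

open import Data.Nat using (ℕ; zero; suc; _+_; _∸_; _≤_)
open import Data.Bool using (Bool)
import Data.Bool.Properties as BoolP
open import Data.Unit using () renaming (⊤ to Unit)
open import Data.Empty using () renaming (⊥ to Empty)
open import Data.Product using (Σ; _×_; _,_; ∃; ∃-syntax)
open import Data.Sum using (_⊎_)
open import Data.List using (List; []; _∷_; map; concat; length; filter; applyUpTo)
open import Data.List.Relation.Unary.All using (All)
open import Data.List.Relation.Unary.Any using (any?)
open import Data.List.Relation.Unary.Linked using (Linked)
open import Data.List.Relation.Unary.Unique.Propositional using (Unique)
open import Data.List.Membership.Propositional using (_∈_)
open import Data.Vec.Properties using (≡-dec)
open import Data.Fin.Subset using (Subset; _⊆_; ∣_∣) renaming (⊥ to ∅; ⊤ to full)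
open import Relation.Binary.PropositionalEquality using (_≡_; _≢_; refl; cong₂)
open import Relation.Binary.Definitions using (DecidableEquality)
open import Relation.Nullary using (¬_; yes; no; Dec)

-- The Boolean lattice Q_n : subsets of [n] = Fin n (as Subset n).
-- A chain in Q_n (or in P) is represented by the list of its elements
-- in increasing order.

_≟S_ : {n : ℕ} → DecidableEquality (Subset n)
_≟S_ = ≡-dec BoolP._≟_

∣_∩S_∣ : {n : ℕ} → List (Subset n) → List (Subset n) → ℕ
∣ A ∩S B ∣ = length (filter (λ x → any? (λ y → x ≟S y) B) A)

SymChain : (n : ℕ) → List (Subset n) → Set
SymChain n C = Linked _⊆_ C ×
  (∃[ j ] ∃[ m ] (j + m + j ≡ n × map ∣_∣ C ≡ applyUpTo (j +_) (suc m)))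

SCD : (n : ℕ) → List (List (Subset n)) → Set
SCD n F = All (SymChain n) F × Unique (concat F) × (∀ (x : Subset n) → x ∈ concat F)

Maximal : {n : ℕ} → List (Subset n) → Set
Maximal {n} A = (∅ ∈ A) × (full ∈ A)

AlmostOrth : (n : ℕ) → List (List (Subset n)) → List (List (Subset n)) → Set
AlmostOrth n F G = ∀ A B → A ∈ F → B ∈ G →
  ((Maximal A × Maximal B) → ∣ A ∩S B ∣ ≡ 2) ×
  (¬ (Maximal A × Maximal B) → ∣ A ∩S B ∣ ≤ 1)

Tup : (ℕ → Set) → List ℕ → Set
Tup F []       = Unit
Tup F (n ∷ ns) = F n × Tup F ns

P : List ℕ → Set
P = Tup Subset

_≟P_ : {ns : List ℕ} → DecidableEquality (P ns)
_≟P_ {[]} _ _ = yes refl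
_≟P_ {n ∷ ns} (a , as) (b , bs) with a ≟S b | _≟P_ {ns} as bs
... | yes refl | yes refl = yes refl
... | no a≢b  | _        = no λ { refl → a≢b refl }
... | yes _    | no as≢bs = no λ { refl → as≢bs refl }

_≤P_ : {ns : List ℕ} → P ns → P ns → Set
_≤P_ {[]} _ _ = Unit
_≤P_ {n ∷ ns} (a , as) (b , bs) = (a ⊆ b) × (_≤P_ {ns} as bs)

rankP : {ns : List ℕ} → P ns → ℕ
rankP {[]} _ = 0
rankP {n ∷ ns} (a , as) = ∣ a ∣ + rankP {ns} as

minP : (ns : List ℕ) → P ns
minP []       = _
minP (n ∷ ns) = ∅ , minP ns

maxP : (ns : List ℕ) → P ns
maxP []       = _
maxP (n ∷ ns) = full , maxP ns

∣_∩P_∣ : {ns : List ℕ} → List (P ns) → List (P ns) → ℕ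
∣ X ∩P Y ∣ = length (filter (λ x → any? (λ y → x ≟P y) Y) X)

-- Cuboids C_1 × ⋯ × C_r, given by a tuple of chains (listed increasingly)

Chains : List ℕ → Set
Chains = Tup (λ n → List (Subset n))

-- position of x in the (increasing) list C, counted from 0
pos : {n : ℕ} → Subset n → List (Subset n) → ℕ
pos x []       = 0
pos x (y ∷ ys) with x ≟S y
... | yes _ = 0
... | no  _ = suc (pos x ys)

InCuboid : {ns : List ℕ} → Chains ns → P ns → Set
InCuboid {[]} _ _ = Unit
InCuboid {n ∷ ns} (C , Cs) (a , as) = (a ∈ C) × InCuboid {ns} Cs as

crank : {ns : List ℕ} → Chains ns → P ns → ℕ
crank {[]} _ _ = 0
crank {n ∷ ns} (C , Cs) (a , as) = pos a C + crank {ns} Cs as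

topRank : {ns : List ℕ} → Chains ns → ℕ
topRank {[]} _ = 0
topRank {n ∷ ns} (C , Cs) = (length C ∸ 1) + topRank {ns} Cs

SymInCuboid : {ns : List ℕ} → Chains ns → List (P ns) → Set
SymInCuboid {ns} Cs X = Linked (_≤P_ {ns}) X × All (InCuboid Cs) X ×
  (∃[ j ] ∃[ m ] (j + m + j ≡ topRank Cs × map (crank Cs) X ≡ applyUpTo (j +_) (suc m)))

SkipsNoRanks : {ns : List ℕ} → List (P ns) → Set
SkipsNoRanks {ns} X = ∃[ k ] (map (rankP {ns}) X ≡ applyUpTo (k +_) (length X))

GoodIndex : {ns : List ℕ} → P ns → P ns → Set
GoodIndex {[]} _ _ = Empty
GoodIndex {n ∷ ns} (a , as) (b , bs) =
  (a ≢ b × ¬ ((a ≡ ∅ × b ≡ full) ⊎ (a ≡ full × b ≡ ∅))) ⊎ GoodIndex {ns} as bs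

Proper : {ns : List ℕ} → List (P ns) → Set
Proper {ns} X = Linked (_≤P_ {ns}) X × SkipsNoRanks X ×
  (∀ a a' → a ∈ X → a' ∈ X → a ≢ a' →
     ¬ ((a ≡ minP ns × a' ≡ maxP ns) ⊎ (a ≡ maxP ns × a' ≡ minP ns)) →
     GoodIndex a a')

SymDecomp : {ns : List ℕ} → Chains ns → List (List (P ns)) → Set
SymDecomp Cs 𝒳 = All (SymInCuboid Cs) 𝒳 × Unique (concat 𝒳) ×
  (∀ a → InCuboid Cs a → a ∈ concat 𝒳)

ProperDecomp : {ns : List ℕ} → Chains ns → List (List (P ns)) → Set
ProperDecomp Cs 𝒳 = SymDecomp Cs 𝒳 × All Proper 𝒳

SCDs : List ℕ → Set
SCDs = Tup (λ n → List (List (Subset n)))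

Hyp : (ns : List ℕ) → SCDs ns → SCDs ns → Chains ns → Chains ns → Set
Hyp [] _ _ _ _ = Unit
Hyp (n ∷ ns) (F1 , F1s) (F2 , F2s) (A , As) (B , Bs) =
  (1 ≤ n × SCD n F1 × SCD n F2 × AlmostOrth n F1 F2 × A ∈ F1 × B ∈ F2) ×
  Hyp ns F1s F2s As Bs

AllMaximal : {ns : List ℕ} → Chains ns → Set
AllMaximal {[]} _ = Unit
AllMaximal {n ∷ ns} (C , Cs) = Maximal C × AllMaximal {ns} Cs

ContainsMinMax : {ns : List ℕ} → List (P ns) → Set
ContainsMinMax {ns} X = (minP ns ∈ X) × (maxP ns ∈ X)

module Submission where

-- Two distinct elements x, x' common to X and Y lie in both cuboids. If they differed
-- at some coordinate i other than by the pair {∅, [n_i]}, then x_i and x'_i would be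
-- two distinct elements of A_i ∩ B_i not forming {∅, [n_i]}; almost orthogonality
-- forbids this, since |A_i ∩ B_i| ≤ 1 or A_i ∩ B_i = {∅, [n_i]}. Properness of X
-- provides such a coordinate for every pair other than {min P, max P}, so X ∩ Y
-- has at most one element unless it is exactly {min P, max P}.

open import Defs
open import Data.Nat using (ℕ; suc; _≤_; z≤n; s≤s)
open import Data.Nat.Properties using (≤-antisym; ≤-trans; ≤-reflexive; 1+n≰n)
open import Data.List using (List; []; _∷_; _++_; concat; filter; length)
open import Data.List.Properties using (length-removeAt′)
open import Data.List.Membership.Propositional using (_∈_; _─_)
open import Data.List.Membership.Propositional.Properties using (∈-filter⁺; ∈-filter⁻)
open import Data.List.Membership.DecPropositional using () renaming (_∈?_ to ∈?)
open import Data.List.Relation.Binary.Subset.Propositional using (_⊆_)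
open import Data.List.Relation.Unary.Any using (here; there; any?)
open import Data.List.Relation.Unary.All as All using (All; []; _∷_)
import Data.List.Relation.Unary.All.Properties as All
open import Data.List.Relation.Unary.AllPairs using ([]; _∷_)
open import Data.List.Relation.Unary.Unique.Propositional using (Unique)
import Data.List.Relation.Unary.Unique.Propositional.Properties as Unique
open import Data.Product using (_×_; _,_; proj₁; proj₂)
open import Data.Sum using (_⊎_; inj₁; inj₂)
open import Data.Empty using (⊥-elim)
open import Function using (_∘_)
open import Data.Fin.Subset using (Subset) renaming (⊥ to ∅; ⊤ to full)
open import Relation.Binary.PropositionalEquality using (_≡_; _≢_; refl; sym; cong; ≢-sym)
open import Relation.Binary.Definitions using (DecidableEquality)
open import Relation.Nullary using (¬_; yes; no; Dec)
open import Relation.Nullary.Decidable using (_×-dec_; _⊎-dec_)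

module _ {A : Set} where

  Unique-++⁻ : ∀ xs {ys : List A} → Unique (xs ++ ys) → Unique xs × Unique ys
  Unique-++⁻ []       u          = [] , u
  Unique-++⁻ (x ∷ xs) (x∉ ∷ u) with Unique-++⁻ xs u
  ... | uxs , uys = (All.++⁻ˡ xs x∉ ∷ uxs) , uys

  Unique-concat⁻ : ∀ {xss} {xs : List A} → Unique (concat xss) → xs ∈ xss → Unique xs
  Unique-concat⁻ {xs ∷ _}  u (here refl) = proj₁ (Unique-++⁻ xs u)
  Unique-concat⁻ {ys ∷ _}  u (there p)   = Unique-concat⁻ (proj₂ (Unique-++⁻ ys u)) p

  ∈-─⁺ : ∀ {x y : A} {ys} (p : x ∈ ys) → y ∈ ys → x ≢ y → y ∈ ys ─ p
  ∈-─⁺ (here refl) (here refl) x≢y = ⊥-elim (x≢y refl)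
  ∈-─⁺ (here refl) (there q)   _   = q
  ∈-─⁺ (there p)   (here refl) _   = here refl
  ∈-─⁺ (there p)   (there q)   x≢y = there (∈-─⁺ p q x≢y)

  Unique-⊆⇒length≤ : ∀ {xs ys : List A} → Unique xs → xs ⊆ ys → length xs ≤ length ys
  Unique-⊆⇒length≤ {[]}             _          _  = z≤n
  Unique-⊆⇒length≤ {x ∷ xs} {ys} (x∉ ∷ u) xs⊆ys = ≤-trans
    (s≤s (Unique-⊆⇒length≤ u λ y∈xs → ∈-─⁺ x∈ys (xs⊆ys (there y∈xs)) (All.lookup x∉ y∈xs)))
    (≤-reflexive (sym (length-removeAt′ ys _)))
    where x∈ys = xs⊆ys (here refl)

  SamePair : A → A → A → A → Set
  SamePair a b p q = (a ≡ p × b ≡ q) ⊎ (a ≡ q × b ≡ p)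

  distinct∈pair⇒SamePair : ∀ {a b p q : A} → a ≢ b →
    a ∈ p ∷ q ∷ [] → b ∈ p ∷ q ∷ [] → SamePair a b p q
  distinct∈pair⇒SamePair a≢b (here refl)         (here refl)         = ⊥-elim (a≢b refl)
  distinct∈pair⇒SamePair _   (here refl)         (there (here refl)) = inj₁ (refl , refl)
  distinct∈pair⇒SamePair _   (there (here refl)) (here refl)         = inj₂ (refl , refl)
  distinct∈pair⇒SamePair a≢b (there (here refl)) (there (here refl)) = ⊥-elim (a≢b refl)

  DistinctPairsAre : A → A → List A → Set
  DistinctPairsAre p q S = ∀ {a b} → a ∈ S → b ∈ S → a ≢ b → SamePair a b p q

module _ {A : Set} (_≟_ : DecidableEquality A) where

  SamePair? : (a b p q : A) → Dec (SamePair a b p q)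
  SamePair? a b p q = ((a ≟ p) ×-dec (b ≟ q)) ⊎-dec ((a ≟ q) ×-dec (b ≟ p))

  infixl 6 _∩_
  _∩_ : List A → List A → List A
  X ∩ Y = filter (λ x → any? (x ≟_) Y) X

  ∈-∩⁺ : ∀ {X Y a} → a ∈ X → a ∈ Y → a ∈ X ∩ Y
  ∈-∩⁺ {Y = Y} = ∈-filter⁺ (λ x → any? (x ≟_) Y)

  ∈-∩⁻ : ∀ {X Y a} → a ∈ X ∩ Y → a ∈ X × a ∈ Y
  ∈-∩⁻ {Y = Y} = ∈-filter⁻ (λ x → any? (x ≟_) Y)

  Unique-∩ : ∀ {X} Y → Unique X → Unique (X ∩ Y)
  Unique-∩ Y = Unique.filter⁺ (λ x → any? (x ≟_) Y)

  length≤1⇒≡ : ∀ {S a b} → length S ≤ 1 → a ∈ S → b ∈ S → a ≡ b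
  length≤1⇒≡ {S} {a} {b} S≤1 a∈S b∈S with a ≟ b
  ... | yes a≡b = a≡b
  ... | no  a≢b = ⊥-elim (1+n≰n (≤-trans (Unique-⊆⇒length≤ [a,b]-unique [a,b]⊆S) S≤1))
    where
    [a,b]-unique : Unique (a ∷ b ∷ [])
    [a,b]-unique = (a≢b ∷ []) ∷ [] ∷ []
    [a,b]⊆S : a ∷ b ∷ [] ⊆ S
    [a,b]⊆S (here refl)         = a∈S
    [a,b]⊆S (there (here refl)) = b∈S

  length≤2⇒⊆pair : ∀ {S p q} → length S ≤ 2 → p ≢ q → p ∈ S → q ∈ S → S ⊆ p ∷ q ∷ []
  length≤2⇒⊆pair {S} {p} {q} S≤2 p≢q p∈S q∈S {c} c∈S with c ≟ p | c ≟ q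
  ... | yes refl | _        = here refl
  ... | no  _    | yes refl = there (here refl)
  ... | no  c≢p  | no  c≢q  =
    ⊥-elim (1+n≰n (≤-trans (Unique-⊆⇒length≤ [p,q,c]-unique [p,q,c]⊆S) S≤2))
    where
    [p,q,c]-unique : Unique (p ∷ q ∷ c ∷ [])
    [p,q,c]-unique = (p≢q ∷ ≢-sym c≢p ∷ []) ∷ (≢-sym c≢q ∷ []) ∷ [] ∷ []
    [p,q,c]⊆S : p ∷ q ∷ c ∷ [] ⊆ S
    [p,q,c]⊆S (here refl)                 = p∈S
    [p,q,c]⊆S (there (here refl))         = q∈S
    [p,q,c]⊆S (there (there (here refl))) = c∈S

  DistinctPairsAre⇒⊆pair : ∀ {S p q} → p ∈ S → DistinctPairsAre p q S → S ⊆ p ∷ q ∷ []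
  DistinctPairsAre⇒⊆pair {p = p} p∈S pairs {c} c∈S with c ≟ p
  ... | yes refl = here refl
  ... | no  c≢p  with pairs c∈S p∈S c≢p
  ...   | inj₁ (c≡p , _) = ⊥-elim (c≢p c≡p)
  ...   | inj₂ (refl , _) = there (here refl)

  DistinctPairsAre⇒length≡2 : ∀ {S p q} → Unique S → p ≢ q → p ∈ S → q ∈ S →
    DistinctPairsAre p q S → length S ≡ 2
  DistinctPairsAre⇒length≡2 {p = p} {q} uS p≢q p∈S q∈S pairs = ≤-antisym
    (Unique-⊆⇒length≤ uS (DistinctPairsAre⇒⊆pair p∈S pairs))
    (Unique-⊆⇒length≤ ((p≢q ∷ []) ∷ [] ∷ []) λ
      { (here refl) → p∈S ; (there (here refl)) → q∈S })

  DistinctPairsAre⇒length≤1 : ∀ {S p q} → Unique S → ¬ (p ∈ S × q ∈ S) →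
    DistinctPairsAre p q S → length S ≤ 1
  DistinctPairsAre⇒length≤1 {[]}    _ _ _ = z≤n
  DistinctPairsAre⇒length≤1 {x ∷ S} uS ¬pq pairs =
    Unique-⊆⇒length≤ {ys = x ∷ []} uS λ c∈S → here (equal c∈S (here refl))
    where
    equal : ∀ {a b} → a ∈ x ∷ S → b ∈ x ∷ S → a ≡ b
    equal {a} {b} a∈ b∈ with a ≟ b
    ... | yes a≡b = a≡b
    ... | no  a≢b with pairs a∈ b∈ a≢b
    ...   | inj₁ (refl , refl) = ⊥-elim (¬pq (a∈ , b∈))
    ...   | inj₂ (refl , refl) = ⊥-elim (¬pq (b∈ , a∈))

∅≢full : ∀ {n} → 1 ≤ n → ∅ {n} ≢ full
∅≢full {suc n} _ ()

AlmostOrth⇒common-pair : ∀ {n F1 F2 A B} {a b : Subset n} → 1 ≤ n →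
  AlmostOrth n F1 F2 → A ∈ F1 → B ∈ F2 →
  a ∈ A → b ∈ A → a ∈ B → b ∈ B → a ≢ b → SamePair a b ∅ full
AlmostOrth⇒common-pair {A = A} {B} n≥1 ao A∈F1 B∈F2 a∈A b∈A a∈B b∈B a≢b
  with ao A B A∈F1 B∈F2
     | (∈? _≟S_ ∅ A ×-dec ∈? _≟S_ full A) ×-dec (∈? _≟S_ ∅ B ×-dec ∈? _≟S_ full B)
... | (∩≡2 , _) | yes maximal@((∅∈A , full∈A) , (∅∈B , full∈B)) =
  distinct∈pair⇒SamePair a≢b (A∩B⊆ (∈-∩⁺ _≟S_ a∈A a∈B)) (A∩B⊆ (∈-∩⁺ _≟S_ b∈A b∈B))
  where
  A∩B⊆ : _∩_ _≟S_ A B ⊆ ∅ ∷ full ∷ []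
  A∩B⊆ = length≤2⇒⊆pair _≟S_ (≤-reflexive (∩≡2 maximal)) (∅≢full n≥1)
    (∈-∩⁺ _≟S_ ∅∈A ∅∈B) (∈-∩⁺ _≟S_ full∈A full∈B)
... | (_ , ∩≤1) | no ¬maximal =
  ⊥-elim (a≢b (length≤1⇒≡ _≟S_ (∩≤1 ¬maximal) (∈-∩⁺ _≟S_ a∈A a∈B) (∈-∩⁺ _≟S_ b∈A b∈B)))

¬GoodIndex-in-both-cuboids : ∀ ns {F1s F2s As Bs} → Hyp ns F1s F2s As Bs →
  ∀ {x x'} → InCuboid As x → InCuboid As x' → InCuboid Bs x → InCuboid Bs x' →
  ¬ GoodIndex x x'
¬GoodIndex-in-both-cuboids (n ∷ ns) ((n≥1 , _ , _ , ao , A∈F1 , B∈F2) , _)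
  (a∈A , _) (b∈A , _) (a∈B , _) (b∈B , _) (inj₁ (a≢b , ¬pair)) =
  ¬pair (AlmostOrth⇒common-pair n≥1 ao A∈F1 B∈F2 a∈A b∈A a∈B b∈B a≢b)
¬GoodIndex-in-both-cuboids (n ∷ ns) (_ , hyps) (_ , x∈A) (_ , x'∈A) (_ , x∈B) (_ , x'∈B) (inj₂ good) =
  ¬GoodIndex-in-both-cuboids ns hyps x∈A x'∈A x∈B x'∈B good

SymInCuboid⇒InCuboid : ∀ {ns} {Cs : Chains ns} {𝒳 X x} →
  All (SymInCuboid Cs) 𝒳 → X ∈ 𝒳 → x ∈ X → InCuboid Cs x
SymInCuboid⇒InCuboid sym𝒳 X∈𝒳 = All.lookup (proj₁ (proj₂ (All.lookup sym𝒳 X∈𝒳)))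

InCuboid-minP-maxP⇒AllMaximal : ∀ ns {Cs : Chains ns} →
  InCuboid Cs (minP ns) → InCuboid Cs (maxP ns) → AllMaximal Cs
InCuboid-minP-maxP⇒AllMaximal []       _              _                = _
InCuboid-minP-maxP⇒AllMaximal (n ∷ ns) (∅∈C , min∈Cs) (full∈C , max∈Cs) =
  (∅∈C , full∈C) , InCuboid-minP-maxP⇒AllMaximal ns min∈Cs max∈Cs

Hyp⇒minP≢maxP : ∀ ns {F1s F2s As Bs} → ns ≢ [] → Hyp ns F1s F2s As Bs → minP ns ≢ maxP ns
Hyp⇒minP≢maxP []      ns≢[] _               = ⊥-elim (ns≢[] refl)
Hyp⇒minP≢maxP (_ ∷ _) _     ((n≥1 , _) , _) = ∅≢full n≥1 ∘ cong proj₁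

module Decompositions {ns F1s F2s As Bs} (hyp : Hyp ns F1s F2s As Bs) {𝒳 𝒴 : List (List (P ns))}
                      (proper𝒳 : ProperDecomp As 𝒳) (sym𝒴 : SymDecomp Bs 𝒴) where

  ∈𝒳⇒InCuboid : ∀ {X x} → X ∈ 𝒳 → x ∈ X → InCuboid As x
  ∈𝒳⇒InCuboid = SymInCuboid⇒InCuboid (proj₁ (proj₁ proper𝒳))

  ∈𝒴⇒InCuboid : ∀ {Y y} → Y ∈ 𝒴 → y ∈ Y → InCuboid Bs y
  ∈𝒴⇒InCuboid = SymInCuboid⇒InCuboid (proj₁ sym𝒴)

  ContainsMinMax⇒AllMaximal : ∀ {X Y} → X ∈ 𝒳 → Y ∈ 𝒴 →
    ContainsMinMax X × ContainsMinMax Y → AllMaximal As × AllMaximal Bs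
  ContainsMinMax⇒AllMaximal X∈𝒳 Y∈𝒴 ((min∈X , max∈X) , (min∈Y , max∈Y)) =
    InCuboid-minP-maxP⇒AllMaximal ns (∈𝒳⇒InCuboid X∈𝒳 min∈X) (∈𝒳⇒InCuboid X∈𝒳 max∈X) ,
    InCuboid-minP-maxP⇒AllMaximal ns (∈𝒴⇒InCuboid Y∈𝒴 min∈Y) (∈𝒴⇒InCuboid Y∈𝒴 max∈Y)

  X∩Y-DistinctPairsAre-minP-maxP : ∀ {X Y} → X ∈ 𝒳 → Y ∈ 𝒴 →
    DistinctPairsAre (minP ns) (maxP ns) (_∩_ _≟P_ X Y)
  X∩Y-DistinctPairsAre-minP-maxP X∈𝒳 Y∈𝒴 {x} {x'} x∈ x'∈ x≢x'
    with ∈-∩⁻ _≟P_ x∈ | ∈-∩⁻ _≟P_ x'∈ | SamePair? _≟P_ x x' (minP ns) (maxP ns)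
  ... | _ | _ | yes pair = pair
  ... | x∈X , x∈Y | x'∈X , x'∈Y | no ¬pair = ⊥-elim (¬GoodIndex-in-both-cuboids ns hyp
          (∈𝒳⇒InCuboid X∈𝒳 x∈X) (∈𝒳⇒InCuboid X∈𝒳 x'∈X) (∈𝒴⇒InCuboid Y∈𝒴 x∈Y) (∈𝒴⇒InCuboid Y∈𝒴 x'∈Y)
          (proj₂ (proj₂ (All.lookup (proj₂ proper𝒳) X∈𝒳)) x x' x∈X x'∈X x≢x' ¬pair))

  Unique-X∩Y : ∀ {X} Y → X ∈ 𝒳 → Unique (_∩_ _≟P_ X Y)
  Unique-X∩Y Y X∈𝒳 = Unique-∩ _≟P_ Y (Unique-concat⁻ (proj₁ (proj₂ (proj₁ proper𝒳))) X∈𝒳)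

  ∣X∩Y∣≤1 : ∀ {X Y} → X ∈ 𝒳 → Y ∈ 𝒴 → ¬ (ContainsMinMax X × ContainsMinMax Y) → ∣ X ∩P Y ∣ ≤ 1
  ∣X∩Y∣≤1 {X} {Y} X∈𝒳 Y∈𝒴 ¬minmax =
    DistinctPairsAre⇒length≤1 _≟P_ (Unique-X∩Y Y X∈𝒳) ¬min,max∈X∩Y
      (X∩Y-DistinctPairsAre-minP-maxP X∈𝒳 Y∈𝒴)
    where
    ¬min,max∈X∩Y : ¬ (minP ns ∈ _∩_ _≟P_ X Y × maxP ns ∈ _∩_ _≟P_ X Y)
    ¬min,max∈X∩Y (min∈ , max∈) with ∈-∩⁻ _≟P_ {X} min∈ | ∈-∩⁻ _≟P_ {X} max∈
    ... | min∈X , min∈Y | max∈X , max∈Y = ¬minmax ((min∈X , max∈X) , (min∈Y , max∈Y))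

  ∣X∩Y∣≡2 : ∀ {X Y} → minP ns ≢ maxP ns → X ∈ 𝒳 → Y ∈ 𝒴 →
    ContainsMinMax X × ContainsMinMax Y → ∣ X ∩P Y ∣ ≡ 2
  ∣X∩Y∣≡2 {Y = Y} min≢max X∈𝒳 Y∈𝒴 ((min∈X , max∈X) , (min∈Y , max∈Y)) =
    DistinctPairsAre⇒length≡2 _≟P_ (Unique-X∩Y Y X∈𝒳) min≢max
      (∈-∩⁺ _≟P_ min∈X min∈Y) (∈-∩⁺ _≟P_ max∈X max∈Y)
      (X∩Y-DistinctPairsAre-minP-maxP X∈𝒳 Y∈𝒴)

lemma4p2 : (ns : List ℕ) → ns ≢ [] →
    (F1s F2s : SCDs ns) (As Bs : Chains ns) → Hyp ns F1s F2s As Bs →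
    (𝒳 𝒴 : List (List (P ns))) → ProperDecomp As 𝒳 → SymDecomp Bs 𝒴 →
    (¬ (AllMaximal As × AllMaximal Bs) →
       ∀ X Y → X ∈ 𝒳 → Y ∈ 𝒴 → ∣ X ∩P Y ∣ ≤ 1) ×
    (AllMaximal As × AllMaximal Bs →
       ∀ X Y → X ∈ 𝒳 → Y ∈ 𝒴 →
         ((ContainsMinMax X × ContainsMinMax Y) → ∣ X ∩P Y ∣ ≡ 2) ×
         (¬ (ContainsMinMax X × ContainsMinMax Y) → ∣ X ∩P Y ∣ ≤ 1))
lemma4p2 ns ns≢[] _ _ _ _ hyp 𝒳 𝒴 proper𝒳 sym𝒴 =
  (λ ¬maximal X Y X∈𝒳 Y∈𝒴 → ∣X∩Y∣≤1 X∈𝒳 Y∈𝒴 (¬maximal ∘ ContainsMinMax⇒AllMaximal X∈𝒳 Y∈𝒴)) ,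
  (λ _ X Y X∈𝒳 Y∈𝒴 → ∣X∩Y∣≡2 (Hyp⇒minP≢maxP ns ns≢[] hyp) X∈𝒳 Y∈𝒴 , ∣X∩Y∣≤1 X∈𝒳 Y∈𝒴)
  where open Decompositions hyp proper𝒳 sym𝒴
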